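{- Let $\delta,\beta>0$, let $T$ be a tournament on $[n]$, and let $\mathcal T$ be any rooted tree produced by the following procedure. Start with the single root node $[n]$. While there is an unprocessed node $V$ with $|V|\ge \sqrt n$, choose a partition $V=L\cup R\cup W$ with $|L|,|R|>\beta|V|$ such that $T\cap(L\times R)$ is $\delta$-regular of density at least $1/2$ ($W$ may be empty), make the nonempty ones among $L,R,W$ the children of $V$, and mark $V$ processed. (Nodes of size less than $\sqrt n$ are never processed and are leaves.) Let $V_1,\dots,V_m$ be the internal (processed) nodes of the final tree and $\Lambda=\sum_{i=1}^m|V_i|$. Then \[ \Lambda\ge \tfrac12\, n\log_3 n . \]
   Context: Nodes of the tree are subsets of $[n]$ and the size of a node is its cardinality. For disjoint $L,R\subseteq[n]$ and $D=T\cap(L\times R)$ (the arcs of $T$ from $L$ to $R$), the density is $d_D(L,R)=|D|/(|L||R|)$, and $D$ is $\delta$-regular if $|d_D(L',R')-d_D(L,R)|<\delta$ for all $L'\subseteq L$, $R'\subseteq R$ with $|L'|>\delta|L|$, $|R'|>\delta|R|$, where $d_D(L',R')=|D\cap(L'\times R')|/(|L'||R'|)$.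
   Formalization: The parameters δ and β range over the positive rationals. -}

module Defs where

open import Data.Nat as ℕ using (ℕ; zero; suc; _^_)
open import Data.Bool using (Bool; true; false; not; _∧_; if_then_else_)
open import Data.Fin using (Fin)
open import Data.Fin.Subset using (Subset; ∣_∣; _∪_; _∩_; _⊆_; ⊥)
open import Data.Vec using (lookup)
open import Data.List using (map; allFin)
open import Data.Nat.ListAction using (sum)
open import Data.Integer using (+_)
open import Data.Rational using (ℚ; 0ℚ; ½; _/_; _*_; _-_; _<_; _≤_) renaming (∣_∣ to absℚ)
open import Data.Product using (_×_)
open import Data.Sum using (_⊎_)
open import Relation.Binary.PropositionalEquality using (_≡_; _≢_)

-- A (Boolean) relation on [n] = Fin n; T i j ≡ true means the arc i → j.
Rel₂ : ℕ → Set
Rel₂ n = Fin n → Fin n → Bool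

IsTournament : {n : ℕ} → Rel₂ n → Set
IsTournament {n} T = ((i : Fin n) → T i i ≡ false)
                   × ((i j : Fin n) → i ≢ j → T i j ≡ not (T j i))

ℕtoℚ : ℕ → ℚ
ℕtoℚ m = (+ m) / 1

-- m / k as a rational; the value for k = 0 is an irrelevant convention
-- (density is only ever evaluated on nonempty L', R').
_÷ℕ_ : ℕ → ℕ → ℚ
m ÷ℕ zero  = 0ℚ
m ÷ℕ suc k = (+ m) / suc k

arcs : {n : ℕ} → Rel₂ n → Subset n → Subset n → ℕ
arcs {n} T A B =
  sum (map (λ i → sum (map (λ j →
         if lookup A i ∧ lookup B j ∧ T i j then 1 else 0) (allFin n))) (allFin n))

-- density d_D(A,B) = |D ∩ (A × B)| / (|A||B|), where D = T ∩ (L × R)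
-- (for A ⊆ L, B ⊆ R, D ∩ (A × B) = T ∩ (A × B))
density : {n : ℕ} → Rel₂ n → Subset n → Subset n → ℚ
density T A B = arcs T A B ÷ℕ (∣ A ∣ ℕ.* ∣ B ∣)

Regular : {n : ℕ} → ℚ → Rel₂ n → Subset n → Subset n → Set
Regular δ T L R =
  ∀ L' R' → L' ⊆ L → R' ⊆ R →
    δ * ℕtoℚ ∣ L ∣ < ℕtoℚ ∣ L' ∣ → δ * ℕtoℚ ∣ R ∣ < ℕtoℚ ∣ R' ∣ →
    absℚ (density T L' R' - density T L R) < δ

Partition3 : {n : ℕ} → Subset n → Subset n → Subset n → Subset n → Set
Partition3 V L R W =
  (V ≡ L ∪ R ∪ W) × (L ∩ R ≡ ⊥) × (L ∩ W ≡ ⊥) × (R ∩ W ≡ ⊥)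

-- Trees produced by the procedure, rooted at node V.
-- "|V| ≥ √n" is written n ≤ |V|², "|V| < √n" as |V|² < n.
-- A node with |V| ≥ √n is always processed (the procedure runs while such
-- an unprocessed node exists); smaller nodes are leaves.
data Proc {n : ℕ} (T : Rel₂ n) (δ β : ℚ) (V : Subset n) : Set where
  leaf  : ∣ V ∣ ^ 2 ℕ.< n → Proc T δ β V
  split : n ℕ.≤ ∣ V ∣ ^ 2 →
          (L R W : Subset n) → Partition3 V L R W →
          β * ℕtoℚ ∣ V ∣ < ℕtoℚ ∣ L ∣ → β * ℕtoℚ ∣ V ∣ < ℕtoℚ ∣ R ∣ →
          Regular δ T L R → ½ ≤ density T L R →
          Proc T δ β L → Proc T δ β R →
          (∣ W ∣ ≡ 0 ⊎ Proc T δ β W) →   -- W is a child only if nonempty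
          Proc T δ β V

Λ : {n : ℕ} {T : Rel₂ n} {δ β : ℚ} {V : Subset n} → Proc T δ β V → ℕ
Λ (leaf _) = 0
Λ {V = V} (split _ _ _ _ _ _ _ _ _ tL tR (Data.Sum.inj₁ _)) = ∣ V ∣ ℕ.+ Λ tL ℕ.+ Λ tR
Λ {V = V} (split _ _ _ _ _ _ _ _ _ tL tR (Data.Sum.inj₂ tW)) = ∣ V ∣ ℕ.+ Λ tL ℕ.+ Λ tR ℕ.+ Λ tW

module Submission where

-- Only the sizes of the nodes matter.  For a node V of size v whose
-- subtree has Λ-value ℓ we show the invariant  v^(2v) ≤ 9^ℓ · n^v.
--   * A leaf has v² < n, hence v^(2v) = (v²)^v ≤ n^v (and ℓ = 0).
--   * A processed node splits as v = a + b + c, and its Λ-value is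
--     v + ℓ_a + ℓ_b + ℓ_c.  The entropy bound  v^v ≤ 3^v a^a b^b c^c
--     (a partition into three parts has entropy at most log 3), squared and
--     combined with the invariant for the children, gives the invariant for V.
-- At the root v = n, so n^(2n) ≤ 9^Λ n^n, i.e. n^n ≤ 3^(2Λ), which is
-- Λ ≥ ½ n log₃ n.

open import Defs
open import Data.Nat using (ℕ; zero; suc; _+_; _^_; _*_; _≤_; _<_; z≤n; s≤s; >-nonZero)
open import Data.Nat.Properties
open import Data.Nat.Tactic.RingSolver using (solve-∀)
open import Data.Rational using (ℚ; 0ℚ) renaming (_<_ to _<ℚ_)
open import Data.Bool using (true; false)
open import Data.Vec using ([]; _∷_)
open import Data.Fin.Subset using (Subset; ⊤; ⊥; _∪_; _∩_; ∣_∣)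
open import Data.Fin.Subset.Properties using (∣⊤∣≡n; ∣⊥∣≡0; ∩-distribˡ-∪; ∪-identityˡ)
open import Data.Product using (_,_)
open import Data.Sum using (inj₁; inj₂)
open import Relation.Binary.PropositionalEquality
  using (_≡_; refl; sym; trans; cong; cong₂; subst; subst₂; module ≡-Reasoning)

^-distribʳ-* : ∀ x y k → (x * y) ^ k ≡ x ^ k * y ^ k
^-distribʳ-* x y zero    = refl
^-distribʳ-* x y (suc k) = trans (cong (x * y *_) (^-distribʳ-* x y k)) (regroup x y (x ^ k) (y ^ k))
  where
  regroup : ∀ x y X Y → x * y * (X * Y) ≡ x * X * (y * Y)
  regroup = solve-∀

-- m^m is never 0 (recall 0^0 = 1); this is what lets us cancel self-powers.
self-power-pos : ∀ m → 0 < m ^ m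
self-power-pos zero    = s≤s z≤n
self-power-pos (suc m) = m^n>0 (suc m) (suc m)

cancel-pos : ∀ {a b} k → 0 < k → k * a ≤ k * b → a ≤ b
cancel-pos k k>0 = *-cancelˡ-≤ k {{>-nonZero k>0}}

rearrangement : ∀ {a b c d} → a ≤ b → c ≤ d → a * d + b * c ≤ a * c + b * d
rearrangement {a} {c = c} a≤b c≤d
  with m≤n⇒∃[o]m+o≡n a≤b | m≤n⇒∃[o]m+o≡n c≤d
... | e , refl | f , refl = subst (a * (c + f) + (a + e) * c ≤_) (excess a e c f) (m≤m+n _ (e * f))
  where
  excess : ∀ a e c f → a * (c + f) + (a + e) * c + e * f ≡ a * c + (a + e) * (c + f)
  excess = solve-∀

power-rearrangement : ∀ m y z → y ^ suc m * z + z ^ suc m * y ≤ y ^ suc m * y + z ^ suc m * z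
power-rearrangement m y z with ≤-total y z
... | inj₁ y≤z = rearrangement (^-monoˡ-≤ (suc m) y≤z) y≤z
... | inj₂ z≤y = subst₂ _≤_ (+-comm (Z * y) (Y * z)) (+-comm (Z * z) (Y * y))
                   (rearrangement (^-monoˡ-≤ (suc m) z≤y) z≤y)
  where
  Y : ℕ
  Y = y ^ suc m
  Z : ℕ
  Z = z ^ suc m

-- Tangent-line inequality  (m+1) y^m z ≤ m y^(m+1) + z^(m+1):  the graph of
-- t ↦ t^(m+1) lies above its tangent at y.  Induction on m, the step being
-- the induction hypothesis times y plus the rearrangement inequality.
tangent : ∀ m y z → suc m * (y ^ m * z) ≤ m * y ^ suc m + z ^ suc m
tangent zero    y z = ≤-reflexive (base y z)
  where
  base : ∀ y z → 1 * (1 * z) ≡ 0 * (y * 1) + z * 1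
  base = solve-∀
tangent (suc m) y z = +-cancelʳ-≤ (y * Z) _ _ (begin
    suc (suc m) * (Y * z) + y * Z              ≡⟨ split-lhs m y (y ^ m) z Z ⟩
    y * (suc m * (y ^ m * z)) + (Y * z + Z * y) ≤⟨ +-mono-≤ (*-monoʳ-≤ y (tangent m y z)) (power-rearrangement m y z) ⟩
    y * (m * Y + Z) + (Y * y + Z * z)           ≡⟨ join-rhs m y Y z Z ⟩
    suc m * (y * Y) + z * Z + y * Z             ∎)
  where
  open ≤-Reasoning
  Y : ℕ
  Y = y ^ suc m
  Z : ℕ
  Z = z ^ suc m
  split-lhs : ∀ m y P z Z → suc (suc m) * (y * P * z) + y * Z ≡ y * (suc m * (P * z)) + (y * P * z + Z * y)
  split-lhs = solve-∀
  join-rhs : ∀ m y Y z Z → y * (m * Y + Z) + (Y * y + Z * z) ≡ suc m * (y * Y) + z * Z + y * Z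
  join-rhs = solve-∀

-- Adding one number x to m numbers with sum S:
--   (m+1)^(m+1) S^m x ≤ m^m (S+x)^(m+1),
-- the tangent inequality at y = (m+1)S, z = m(S+x), divided by m.
amgm-step : ∀ m S x → suc m ^ suc m * (S ^ m * x) ≤ m ^ m * (S + x) ^ suc m
amgm-step zero    S x = subst₂ _≤_ (lhs x) (rhs S x) (m≤n+m x S)
  where
  lhs : ∀ x → x ≡ 1 * 1 * (1 * x)
  lhs = solve-∀
  rhs : ∀ S x → S + x ≡ 1 * ((S + x) * 1)
  rhs = solve-∀
amgm-step m@(suc _) S x = *-cancelˡ-≤ m (+-cancelˡ-≤ common _ _ (begin
    common + m * (K * (P * x))        ≡⟨ expand-lhs m K′ P S x ⟩
    suc m * (K′ * P * (m * (S + x)))  ≡⟨ cong (λ t → suc m * (t * (m * (S + x)))) (sym (^-distribʳ-* (suc m) S m)) ⟩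
    suc m * ((suc m * S) ^ m * (m * (S + x)))
      ≤⟨ tangent m (suc m * S) (m * (S + x)) ⟩
    m * (suc m * S) ^ suc m + (m * (S + x)) ^ suc m
      ≡⟨ cong₂ (λ s t → m * s + t) (^-distribʳ-* (suc m) S (suc m)) (^-distribʳ-* m (S + x) (suc m)) ⟩
    m * (K * (S * P)) + m * M * ((S + x) * Q) ≡⟨ cong (common +_) (*-assoc m M _) ⟩
    common + m * (M * ((S + x) * Q))  ∎))
  where
  open ≤-Reasoning
  K′ : ℕ
  K′ = suc m ^ m
  K : ℕ
  K  = suc m * K′
  P : ℕ
  P  = S ^ m
  M : ℕ
  M  = m ^ m
  Q : ℕ
  Q  = (S + x) ^ m
  common : ℕ
  common = m * (K * (S * P))
  expand-lhs : ∀ m K P S x → m * (suc m * K * (S * P)) + m * (suc m * K * (P * x)) ≡ suc m * (K * P * (m * (S + x)))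
  expand-lhs = solve-∀

weighted-amgm : ∀ a b x y → (a + b) ^ (a + b) * (x ^ a * y ^ b) ≤ (a * x + b * y) ^ (a + b)
weighted-amgm zero b x y = ≤-reflexive (begin
    b ^ b * (1 * y ^ b) ≡⟨ cong (b ^ b *_) (*-identityˡ (y ^ b)) ⟩
    b ^ b * y ^ b       ≡⟨ sym (^-distribʳ-* b y b) ⟩
    (b * y) ^ b         ∎)
  where open ≡-Reasoning
weighted-amgm (suc a) b x y = cancel-pos (v ^ v) (self-power-pos v) (begin
    v ^ v * (suc v ^ suc v * (x * x ^ a * y ^ b)) ≡⟨ regroup (v ^ v) (suc v ^ suc v) x (x ^ a) (y ^ b) ⟩
    suc v ^ suc v * x * (v ^ v * (x ^ a * y ^ b)) ≤⟨ *-monoʳ-≤ (suc v ^ suc v * x) (weighted-amgm a b x y) ⟩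
    suc v ^ suc v * x * S ^ v                     ≡⟨ swap (suc v ^ suc v) x (S ^ v) ⟩
    suc v ^ suc v * (S ^ v * x)                   ≤⟨ amgm-step v S x ⟩
    v ^ v * (S + x) ^ suc v                       ≡⟨ cong (λ t → v ^ v * t ^ suc v) (reassoc x (a * x) (b * y)) ⟩
    v ^ v * (x + a * x + b * y) ^ suc v           ∎)
  where
  open ≤-Reasoning
  v : ℕ
  v = a + b
  S : ℕ
  S = a * x + b * y
  regroup : ∀ V W x X Y → V * (W * (x * X * Y)) ≡ W * x * (V * (X * Y))
  regroup = solve-∀
  swap : ∀ W x T → W * x * T ≡ W * (T * x)
  swap = solve-∀
  reassoc : ∀ x p q → p + q + x ≡ x + p + q
  reassoc = solve-∀

gibbs₁ : ∀ a p r → p ≤ r → a ^ a * p ^ a ≤ r ^ a * a ^ a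
gibbs₁ a p r p≤r = subst (a ^ a * p ^ a ≤_) (*-comm (a ^ a) (r ^ a)) (*-monoʳ-≤ (a ^ a) (^-monoˡ-≤ a p≤r))

-- Gibbs' inequality for two outcomes with weights p, q:
--   (a+b)^(a+b) p^a q^b ≤ (p+q)^(a+b) a^a b^b.
-- For a, b > 0 this is weighted AM–GM at x = p b, y = q a, divided by a^b b^a.
gibbs₂ : ∀ a b p q → (a + b) ^ (a + b) * (p ^ a * q ^ b) ≤ (p + q) ^ (a + b) * (a ^ a * b ^ b)
gibbs₂ zero b p q =
  subst₂ (λ s t → b ^ b * s ≤ (p + q) ^ b * t) (sym (*-identityˡ (q ^ b))) (sym (*-identityˡ (b ^ b)))
         (gibbs₁ b q (p + q) (m≤n+m q p))
gibbs₂ a zero p q =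
  subst (λ v → v ^ v * (p ^ a * 1) ≤ (p + q) ^ v * (a ^ a * 1)) (sym (+-identityʳ a))
        (subst₂ (λ s t → a ^ a * s ≤ (p + q) ^ a * t) (sym (*-identityʳ (p ^ a))) (sym (*-identityʳ (a ^ a)))
                (gibbs₁ a p (p + q) (m≤m+n p q)))
gibbs₂ a@(suc _) b@(suc _) p q = cancel-pos (a ^ b * b ^ a) (*-mono-< (m^n>0 a b) (m^n>0 b a)) (begin
    a ^ b * b ^ a * (v ^ v * (p ^ a * q ^ b))        ≡⟨ regroup (a ^ b) (b ^ a) (v ^ v) (p ^ a) (q ^ b) ⟩
    v ^ v * ((p ^ a * b ^ a) * (q ^ b * a ^ b))      ≡⟨ sym (cong (λ t → v ^ v * t) (cong₂ _*_ (^-distribʳ-* p b a) (^-distribʳ-* q a b))) ⟩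
    v ^ v * ((p * b) ^ a * (q * a) ^ b)              ≤⟨ weighted-amgm a b (p * b) (q * a) ⟩
    (a * (p * b) + b * (q * a)) ^ v                  ≡⟨ cong (_^ v) (factor a b p q) ⟩
    ((p + q) * (a * b)) ^ v                          ≡⟨ trans (^-distribʳ-* (p + q) (a * b) v) (cong ((p + q) ^ v *_) (^-distribʳ-* a b v)) ⟩
    (p + q) ^ v * (a ^ v * b ^ v)                    ≡⟨ cong (λ t → (p + q) ^ v * t) (cong₂ _*_ (^-distribˡ-+-* a a b) (^-distribˡ-+-* b a b)) ⟩
    (p + q) ^ v * (a ^ a * a ^ b * (b ^ a * b ^ b))  ≡⟨ separate ((p + q) ^ v) (a ^ a) (a ^ b) (b ^ a) (b ^ b) ⟩
    a ^ b * b ^ a * ((p + q) ^ v * (a ^ a * b ^ b))  ∎)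
  where
  open ≤-Reasoning
  v : ℕ
  v = a + b
  regroup : ∀ ab ba V P Q → ab * ba * (V * (P * Q)) ≡ V * ((P * ba) * (Q * ab))
  regroup = solve-∀
  factor : ∀ a b p q → a * (p * b) + b * (q * a) ≡ (p + q) * (a * b)
  factor = solve-∀
  separate : ∀ R aa ab ba bb → R * (aa * ab * (ba * bb)) ≡ ab * ba * (R * (aa * bb))
  separate = solve-∀

-- Three-part entropy bound  v^v ≤ 3^v a^a b^b c^c  for v = a + b + c:
-- Gibbs with weights (1,1) on a, b and with weights (2,1) on a + b, c.
three-part-entropy : ∀ a b c → (a + b + c) ^ (a + b + c) ≤ 3 ^ (a + b + c) * (a ^ a * b ^ b * c ^ c)
three-part-entropy a b c = cancel-pos (2 ^ u * U) (*-mono-< (m^n>0 2 u) (self-power-pos u)) (begin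
    2 ^ u * U * v ^ v                           ≡⟨ regroup (2 ^ u) U (v ^ v) ⟩
    U * (v ^ v * 2 ^ u)                         ≤⟨ *-monoʳ-≤ U split-ab-c ⟩
    U * (3 ^ v * (U * c ^ c))                   ≡⟨ regroup′ U (3 ^ v) (c ^ c) ⟩
    U * (U * (3 ^ v * c ^ c))                   ≤⟨ *-monoˡ-≤ (U * (3 ^ v * c ^ c)) split-a-b ⟩
    2 ^ u * (a ^ a * b ^ b) * (U * (3 ^ v * c ^ c)) ≡⟨ regroup″ (2 ^ u) (a ^ a) (b ^ b) U (3 ^ v) (c ^ c) ⟩
    2 ^ u * U * (3 ^ v * (a ^ a * b ^ b * c ^ c)) ∎)
  where
  open ≤-Reasoning
  u : ℕ
  u = a + b
  v : ℕ
  v = a + b + c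
  U : ℕ
  U = u ^ u
  split-a-b : U ≤ 2 ^ u * (a ^ a * b ^ b)
  split-a-b = subst (_≤ 2 ^ u * (a ^ a * b ^ b))
                    (trans (cong (λ t → U * (t * 1 ^ b)) (^-zeroˡ a)) (trans (cong (λ t → U * (1 * t)) (^-zeroˡ b)) (*-identityʳ U)))
                    (gibbs₂ a b 1 1)
  split-ab-c : v ^ v * 2 ^ u ≤ 3 ^ v * (U * c ^ c)
  split-ab-c = subst (_≤ 3 ^ v * (U * c ^ c))
                     (trans (cong (λ t → v ^ v * (2 ^ u * t)) (^-zeroˡ c)) (cong (v ^ v *_) (*-identityʳ (2 ^ u))))
                     (gibbs₂ u c 2 1)
  regroup : ∀ T U V → T * U * V ≡ U * (V * T)
  regroup = solve-∀
  regroup′ : ∀ U T C → U * (T * (U * C)) ≡ U * (U * (T * C))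
  regroup′ = solve-∀
  regroup″ : ∀ T A B U R C → T * (A * B) * (U * (R * C)) ≡ T * U * (R * (A * B * C))
  regroup″ = solve-∀

∣p∪q∣+∣p∩q∣ : ∀ {n} (p q : Subset n) → ∣ p ∪ q ∣ + ∣ p ∩ q ∣ ≡ ∣ p ∣ + ∣ q ∣
∣p∪q∣+∣p∩q∣ []          []          = refl
∣p∪q∣+∣p∩q∣ (true ∷ p)  (true ∷ q)  = cong suc (trans (+-suc (∣ p ∪ q ∣) (∣ p ∩ q ∣))
                                        (trans (cong suc (∣p∪q∣+∣p∩q∣ p q)) (sym (+-suc (∣ p ∣) (∣ q ∣)))))
∣p∪q∣+∣p∩q∣ (true ∷ p)  (false ∷ q) = cong suc (∣p∪q∣+∣p∩q∣ p q)
∣p∪q∣+∣p∩q∣ (false ∷ p) (true ∷ q)  = trans (cong suc (∣p∪q∣+∣p∩q∣ p q)) (sym (+-suc (∣ p ∣) (∣ q ∣)))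
∣p∪q∣+∣p∩q∣ (false ∷ p) (false ∷ q) = ∣p∪q∣+∣p∩q∣ p q

∣disjoint-∪∣ : ∀ {n} (p q : Subset n) → p ∩ q ≡ ⊥ → ∣ p ∪ q ∣ ≡ ∣ p ∣ + ∣ q ∣
∣disjoint-∪∣ {n} p q p∩q≡⊥ = begin
    ∣ p ∪ q ∣              ≡⟨ sym (+-identityʳ ∣ p ∪ q ∣) ⟩
    ∣ p ∪ q ∣ + 0          ≡⟨ cong (∣ p ∪ q ∣ +_) (sym (trans (cong ∣_∣ p∩q≡⊥) (∣⊥∣≡0 n))) ⟩
    ∣ p ∪ q ∣ + ∣ p ∩ q ∣  ≡⟨ ∣p∪q∣+∣p∩q∣ p q ⟩
    ∣ p ∣ + ∣ q ∣          ∎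
  where open ≡-Reasoning

partition-size : ∀ {n} {V L R W : Subset n} → Partition3 V L R W → ∣ V ∣ ≡ ∣ L ∣ + ∣ R ∣ + ∣ W ∣
partition-size {L = L} {R} {W} (refl , L∩R≡⊥ , L∩W≡⊥ , R∩W≡⊥) = begin
    ∣ L ∪ (R ∪ W) ∣        ≡⟨ ∣disjoint-∪∣ L (R ∪ W) L∩[R∪W]≡⊥ ⟩
    ∣ L ∣ + ∣ R ∪ W ∣      ≡⟨ cong (∣ L ∣ +_) (∣disjoint-∪∣ R W R∩W≡⊥) ⟩
    ∣ L ∣ + (∣ R ∣ + ∣ W ∣) ≡⟨ sym (+-assoc (∣ L ∣) (∣ R ∣) (∣ W ∣)) ⟩
    ∣ L ∣ + ∣ R ∣ + ∣ W ∣   ∎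
  where
  open ≡-Reasoning
  L∩[R∪W]≡⊥ : L ∩ (R ∪ W) ≡ ⊥
  L∩[R∪W]≡⊥ = trans (∩-distribˡ-∪ L R W) (trans (cong₂ _∪_ L∩R≡⊥ L∩W≡⊥) (∪-identityˡ ⊥))

NodeBound : ℕ → ℕ → ℕ → Set
NodeBound n v ℓ = v ^ v * v ^ v ≤ 9 ^ ℓ * n ^ v

leaf-bound : ∀ {n} v → v ^ 2 < n → NodeBound n v 0
leaf-bound {n} v v²<n = begin
    v ^ v * v ^ v ≡⟨ sym (^-distribʳ-* v v v) ⟩
    (v * v) ^ v   ≤⟨ ^-monoˡ-≤ v (subst (_≤ n) (cong (v *_) (*-identityʳ v)) (<⇒≤ v²<n)) ⟩
    n ^ v         ≡⟨ sym (*-identityˡ (n ^ v)) ⟩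
    1 * n ^ v     ∎
  where open ≤-Reasoning

empty-bound : ∀ {n} → NodeBound n 0 0
empty-bound = ≤-refl

merge-bound : ∀ {n} a b c ℓa ℓb ℓc → NodeBound n a ℓa → NodeBound n b ℓb → NodeBound n c ℓc →
              NodeBound n (a + b + c) (a + b + c + ℓa + ℓb + ℓc)
merge-bound {n} a b c ℓa ℓb ℓc bound-a bound-b bound-c = begin
    v ^ v * v ^ v                               ≤⟨ *-mono-≤ entropy entropy ⟩
    3 ^ v * (A * B * C) * (3 ^ v * (A * B * C)) ≡⟨ square-out (3 ^ v) A B C ⟩
    3 ^ v * 3 ^ v * ((A * A) * (B * B) * (C * C)) ≡⟨ cong (_* ((A * A) * (B * B) * (C * C))) (sym (^-distribʳ-* 3 3 v)) ⟩
    9 ^ v * ((A * A) * (B * B) * (C * C))       ≤⟨ *-monoʳ-≤ (9 ^ v) (*-mono-≤ (*-mono-≤ bound-a bound-b) bound-c) ⟩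
    9 ^ v * ((9 ^ ℓa * n ^ a) * (9 ^ ℓb * n ^ b) * (9 ^ ℓc * n ^ c))
      ≡⟨ collect (9 ^ v) (9 ^ ℓa) (9 ^ ℓb) (9 ^ ℓc) (n ^ a) (n ^ b) (n ^ c) ⟩
    9 ^ v * 9 ^ ℓa * 9 ^ ℓb * 9 ^ ℓc * (n ^ a * n ^ b * n ^ c)
      ≡⟨ cong₂ _*_ (sym (^-distrib-sum 9 v ℓa ℓb ℓc)) (sym (^-distrib-sum′ n a b c)) ⟩
    9 ^ (v + ℓa + ℓb + ℓc) * n ^ v              ∎
  where
  open ≤-Reasoning
  v : ℕ
  v = a + b + c
  A : ℕ
  A = a ^ a
  B : ℕ
  B = b ^ b
  C : ℕ
  C = c ^ c
  entropy : v ^ v ≤ 3 ^ v * (A * B * C)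
  entropy = three-part-entropy a b c
  ^-distrib-sum′ : ∀ x a b c → x ^ (a + b + c) ≡ x ^ a * x ^ b * x ^ c
  ^-distrib-sum′ x a b c = trans (^-distribˡ-+-* x (a + b) c) (cong (_* x ^ c) (^-distribˡ-+-* x a b))
  ^-distrib-sum : ∀ x a b c d → x ^ (a + b + c + d) ≡ x ^ a * x ^ b * x ^ c * x ^ d
  ^-distrib-sum x a b c d = trans (^-distribˡ-+-* x (a + b + c) d) (cong (_* x ^ d) (^-distrib-sum′ x a b c))
  square-out : ∀ T A B C → T * (A * B * C) * (T * (A * B * C)) ≡ T * T * ((A * A) * (B * B) * (C * C))
  square-out = solve-∀
  collect : ∀ V Fa Fb Fc Na Nb Nc → V * ((Fa * Na) * (Fb * Nb) * (Fc * Nc)) ≡ V * Fa * Fb * Fc * (Na * Nb * Nc)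
  collect = solve-∀

proc-bound : ∀ {n} {T : Rel₂ n} {δ β : ℚ} {V : Subset n} (t : Proc T δ β V) → NodeBound n ∣ V ∣ (Λ t)
proc-bound {V = V} (leaf small) = leaf-bound ∣ V ∣ small
proc-bound {n} {V = V} (split _ L R W partition _ _ _ _ tL tR (inj₁ ∣W∣≡0)) =
  subst (λ v → NodeBound n v (v + Λ tL + Λ tR)) (sym ∣V∣≡)
        (subst (NodeBound n (∣ L ∣ + ∣ R ∣ + 0)) (+-identityʳ (∣ L ∣ + ∣ R ∣ + 0 + Λ tL + Λ tR))
               (merge-bound (∣ L ∣) (∣ R ∣) 0 (Λ tL) (Λ tR) 0 (proc-bound tL) (proc-bound tR) (empty-bound {n})))
  where
  ∣V∣≡ : ∣ V ∣ ≡ ∣ L ∣ + ∣ R ∣ + 0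
  ∣V∣≡ = trans (partition-size partition) (cong (∣ L ∣ + ∣ R ∣ +_) ∣W∣≡0)
proc-bound {n} (split _ L R W partition _ _ _ _ tL tR (inj₂ tW)) =
  subst (λ v → NodeBound n v (v + Λ tL + Λ tR + Λ tW)) (sym (partition-size partition))
        (merge-bound (∣ L ∣) (∣ R ∣) (∣ W ∣) (Λ tL) (Λ tR) (Λ tW) (proc-bound tL) (proc-bound tR) (proc-bound tW))

lemma3p1 : (δ β : ℚ) → 0ℚ <ℚ δ → 0ℚ <ℚ β →
    (n : ℕ) (T : Rel₂ n) → IsTournament T →
    (𝒯 : Proc T δ β ⊤) →
    n ^ n ≤ 3 ^ (2 * Λ 𝒯)
lemma3p1 δ β _ _ n T _ 𝒯 = begin
    n ^ n          ≤⟨ cancel-pos (n ^ n) (self-power-pos n) (subst (n ^ n * n ^ n ≤_) (*-comm (9 ^ Λ 𝒯) (n ^ n)) root-bound) ⟩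
    9 ^ Λ 𝒯        ≡⟨ ^-*-assoc 3 2 (Λ 𝒯) ⟩
    3 ^ (2 * Λ 𝒯)  ∎
  where
  open ≤-Reasoning
  root-bound : NodeBound n n (Λ 𝒯)
  root-bound = subst (λ v → NodeBound n v (Λ 𝒯)) (∣⊤∣≡n n) (proc-bound 𝒯)
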